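{- Let $A$ be an arbitrary formula, $\alpha$ a heap label, and $\pi_1,\pi_2$ permissions such that $\pi_1\oplus\pi_2$ is defined. Then \[ (@_\alpha A)^{\pi_1\oplus\pi_2} \models (@_\alpha A)^{\pi_1}\circledast(@_\alpha A)^{\pi_2} \qquad\text{and}\qquad (@_\alpha A)^{\pi_1}\circledast(@_\alpha A)^{\pi_2} \models (@_\alpha A)^{\pi_1\oplus\pi_2}. \]
   Context: Setting (separation logic with labels and permissions). Fix a set $\mathsf{Val}$ of values, a set $\mathsf{Loc}\subseteq \mathsf{Val}$ of locations, a set of program variables, and a set $\mathsf{Label}$ of label variables. A permission algebra $\langle \mathsf{Perm},\oplus,\otimes,\top\rangle$ is given: $\oplus$ is a partial binary operation making $\langle\mathsf{Perm},\oplus\rangle$ a partial cancellative commutative semigroup (with divisibility: every $\pi$ equals $\pi_1\oplus\pi_2$ for some $\pi_1,\pi_2$; $\pi\oplus\top$ is undefined for all $\pi$; no unit: $\pi_1\neq\pi_1\oplus\pi_2$), $\otimes$ is a total binary operation, and $(\pi_1\oplus\pi_2)\otimes\pi=(\pi_1\otimes\pi)\oplus(\pi_2\otimes\pi)$ for all $\pi,\pi_1,\pi_2$. A stack $s$ maps variables to values. A p-heap is a finite partial function $h:\mathsf{Loc}\rightharpoonup \mathsf{Val}\times\mathsf{Perm}$; $\mathrm{dom}(h)$ is its domain. Weak composition $h_1\mathrel{\overline{\circ}} h_2$ is defined iff for every $\ell\in\mathrm{dom}(h_1)\cap\mathrm{dom}(h_2)$, $h_1(\ell)=(v,\pi_1)$,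 $h_2(\ell)=(v,\pi_2)$ with the same $v$ and $\pi_1\oplus\pi_2$ defined; then $(h_1\mathrel{\overline{\circ}} h_2)(\ell)=h_i(\ell)$ if $\ell$ is only in $\mathrm{dom}(h_i)$, and $=(v,\pi_1\oplus\pi_2)$ on the overlap. For a permission $\pi$, $(\pi\cdot h)(\ell)=(v,\pi\otimes\pi')$ whenever $h(\ell)=(v,\pi')$ (same domain as $h$). A valuation $\rho$ assigns a p-heap $\rho(\alpha)$ to each label $\alpha$. Formulas are interpreted by a satisfaction relation $s,h,\rho\models\Phi$, where: $s,h,\rho\models A_1\circledast A_2$ iff $h=h_1\mathrel{\overline{\circ}} h_2$ for some $h_1,h_2$ with $s,h_i,\rho\models A_i$; $s,h,\rho\models @_\alpha A$ iff $h=\rho(\alpha)$ and $s,\rho(\alpha),\rho\models A$; $s,h,\rho\models A^\pi$ iff $h=\pi\cdot h'$ for some $h'$ with $s,h',\rho\models A$. Entailment $\Phi\models\Psi$ means: for all $s,h,\rho$, if $s,h,\rho\models\Phi$ then $s,h,\rho\models\Psi$. -}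

module Defs where

open import Data.Maybe using (Maybe; just; nothing; map; _>>=_)
open import Data.Product using (Σ; ∃; ∃-syntax; _×_; _,_)
open import Data.List using (List)
open import Data.List.Membership.Propositional using (_∈_)
open import Relation.Binary.PropositionalEquality using (_≡_)
open import Relation.Nullary using (¬_)

-- Permission algebra ⟨Perm, ⊕, ⊗, ⊤⟩.  The partial operation ⊕ is
-- rendered as a Maybe-valued function: π₁ ⊕ π₂ is defined iff it is 'just _'.
record PermAlg : Set₁ where
  field
    Perm   : Set
    _⊕_    : Perm → Perm → Maybe Perm
    _⊗_    : Perm → Perm → Perm
    ⊤ₚ     : Perm
    ⊕-comm  : ∀ p q → p ⊕ q ≡ q ⊕ p
    ⊕-assoc : ∀ p q r → ((p ⊕ q) >>= (λ pq → pq ⊕ r)) ≡ ((q ⊕ r) >>= (λ qr → p ⊕ qr))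
    ⊕-cancel : ∀ p q q' r → p ⊕ q ≡ just r → p ⊕ q' ≡ just r → q ≡ q'
    ⊕-div    : ∀ p → ∃[ p₁ ] ∃[ p₂ ] (p₁ ⊕ p₂ ≡ just p)
    ⊕-top    : ∀ p → p ⊕ ⊤ₚ ≡ nothing
    ⊕-nounit : ∀ p₁ p₂ → ¬ (p₁ ⊕ p₂ ≡ just p₁)
    distrib  : ∀ p₁ p₂ p π → p₁ ⊕ p₂ ≡ just p →
               (p₁ ⊗ π) ⊕ (p₂ ⊗ π) ≡ just (p ⊗ π)

module Semantics (Val Loc Var Label : Set) (PA : PermAlg) where
  open PermAlg PA

  Stack : Set
  Stack = Var → Val

  record PHeap : Set where
    field
      fun    : Loc → Maybe (Val × Perm)
      finite : ∃[ xs ] (∀ ℓ vp → fun ℓ ≡ just vp → ℓ ∈ xs)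
  open PHeap public

  Valuation : Set
  Valuation = Label → PHeap

  _≈ₕ_ : PHeap → PHeap → Set
  h ≈ₕ h' = ∀ ℓ → fun h ℓ ≡ fun h' ℓ

  -- pointwise behaviour of weak composition: CompAt a b c means
  -- "a ∘̄ b is defined at this location and equals c"
  data CompAt : Maybe (Val × Perm) → Maybe (Val × Perm) → Maybe (Val × Perm) → Set where
    none  : CompAt nothing nothing nothing
    left  : ∀ x → CompAt (just x) nothing (just x)
    right : ∀ x → CompAt nothing (just x) (just x)
    both  : ∀ v p₁ p₂ p → p₁ ⊕ p₂ ≡ just p →
            CompAt (just (v , p₁)) (just (v , p₂)) (just (v , p))

  IsWComp : PHeap → PHeap → PHeap → Set
  IsWComp h h₁ h₂ = ∀ ℓ → CompAt (fun h₁ ℓ) (fun h₂ ℓ) (fun h ℓ)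

  IsScale : PHeap → Perm → PHeap → Set
  IsScale h π h' = ∀ ℓ → fun h ℓ ≡ map (λ { (v , p) → (v , π ⊗ p) }) (fun h' ℓ)

  data Formula : Set₁ where
    atom : (Stack → PHeap → Valuation → Set) → Formula
    _⊛_  : Formula → Formula → Formula
    at   : Label → Formula → Formula
    _^_  : Formula → Perm → Formula

  _,_,_⊨_ : Stack → PHeap → Valuation → Formula → Set
  s , h , ρ ⊨ atom P  = P s h ρ
  s , h , ρ ⊨ (A ⊛ B) = ∃[ h₁ ] ∃[ h₂ ] (IsWComp h h₁ h₂ × (s , h₁ , ρ ⊨ A) × (s , h₂ , ρ ⊨ B))
  s , h , ρ ⊨ at α A  = (h ≈ₕ ρ α) × (s , ρ α , ρ ⊨ A)
  s , h , ρ ⊨ (A ^ π) = ∃[ h' ] (IsScale h π h' × (s , h' , ρ ⊨ A))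

  _⊨ₑ_ : Formula → Formula → Set
  Φ ⊨ₑ Ψ = ∀ s h ρ → s , h , ρ ⊨ Φ → s , h , ρ ⊨ Ψ

-- The formula (@α A)^π holds exactly at the heap π·ρ(α) (given that A holds at
-- ρ(α)), so both entailments reduce to the heap identity
-- π·h = (π₁·h) ∘̄ (π₂·h) for π = π₁ ⊕ π₂, which is distributivity of ⊗ over ⊕
-- read pointwise. For the second entailment one also needs that weak
-- composition is a partial function, which holds because ⊕ is one.
module Submission where

open import Defs
open import Data.Maybe using (Maybe; just; nothing; map)
open import Data.Maybe.Properties using (just-injective)
open import Data.Product using (_×_; _,_; ∃-syntax)
open import Relation.Binary.PropositionalEquality
  using (_≡_; refl; sym; trans; cong; subst; subst₂)

module LabelledPermissions (Val Loc Var Label : Set) (PA : PermAlg) where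
  open PermAlg PA
  open Semantics Val Loc Var Label PA

  scaleCell : Perm → Val × Perm → Val × Perm
  scaleCell π (v , p) = (v , π ⊗ p)

  map-≡-just⁻¹ : ∀ {f : Val × Perm → Val × Perm} (m : Maybe (Val × Perm)) {y} →
                 map f m ≡ just y → ∃[ x ] (m ≡ just x)
  map-≡-just⁻¹ (just x) _ = x , refl

  scale : Perm → PHeap → PHeap
  fun (scale π h) ℓ = map (scaleCell π) (fun h ℓ)
  finite (scale π h) with finite h
  ... | xs , bounded = xs , λ ℓ _ eq →
    let (x , defined) = map-≡-just⁻¹ (fun h ℓ) eq in bounded ℓ x defined

  CompAt-functional : ∀ {a b c c'} → CompAt a b c → CompAt a b c' → c ≡ c'
  CompAt-functional none      none      = refl
  CompAt-functional (left x)  (left .x) = refl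
  CompAt-functional (right x) (right .x) = refl
  CompAt-functional (both v p₁ p₂ p p₁⊕p₂≡p) (both .v .p₁ .p₂ p' p₁⊕p₂≡p') =
    cong (λ q → just (v , q)) (just-injective (trans (sym p₁⊕p₂≡p) p₁⊕p₂≡p'))

  CompAt-scaleCell : ∀ {π₁ π₂ π} → π₁ ⊕ π₂ ≡ just π → (m : Maybe (Val × Perm)) →
    CompAt (map (scaleCell π₁) m) (map (scaleCell π₂) m) (map (scaleCell π) m)
  CompAt-scaleCell _         nothing        = none
  CompAt-scaleCell π₁⊕π₂≡π (just (v , p)) = both v _ _ _ (distrib _ _ _ p π₁⊕π₂≡π)

  IsWComp-scale : ∀ {π₁ π₂ π} → π₁ ⊕ π₂ ≡ just π → ∀ h →
                  IsWComp (scale π h) (scale π₁ h) (scale π₂ h)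
  IsWComp-scale π₁⊕π₂≡π h ℓ = CompAt-scaleCell π₁⊕π₂≡π (fun h ℓ)

  IsWComp-scale⁻¹ : ∀ {π₁ π₂ π} → π₁ ⊕ π₂ ≡ just π → ∀ h h₁ h₂ h' →
                    h₁ ≈ₕ scale π₁ h' → h₂ ≈ₕ scale π₂ h' → IsWComp h h₁ h₂ →
                    h ≈ₕ scale π h'
  IsWComp-scale⁻¹ π₁⊕π₂≡π h _ _ h' h₁≈π₁·h' h₂≈π₂·h' h≡h₁∘h₂ ℓ =
    CompAt-functional
      (subst₂ (λ a b → CompAt a b (fun h ℓ)) (h₁≈π₁·h' ℓ) (h₂≈π₂·h' ℓ) (h≡h₁∘h₂ ℓ))
      (IsWComp-scale π₁⊕π₂≡π h' ℓ)

  at^-elim : ∀ A α π s h ρ → s , h , ρ ⊨ (at α A ^ π) →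
             (h ≈ₕ scale π (ρ α)) × (s , ρ α , ρ ⊨ A)
  at^-elim _ _ π _ _ _ (_ , h≡π·h' , h'≈ρα , A-holds) =
    (λ ℓ → trans (h≡π·h' ℓ) (cong (map (scaleCell π)) (h'≈ρα ℓ))) , A-holds

  at^-intro : ∀ A α π s h ρ → h ≈ₕ scale π (ρ α) → s , ρ α , ρ ⊨ A →
              s , h , ρ ⊨ (at α A ^ π)
  at^-intro _ α _ _ _ ρ h≈π·ρα A-holds = ρ α , h≈π·ρα , (λ _ → refl) , A-holds

lemma2 : (Val Loc Var Label : Set) (PA : PermAlg) →
    let open PermAlg PA
        open Semantics Val Loc Var Label PA
    in ∀ (A : Formula) (α : Label) (π₁ π₂ π : Perm) → π₁ ⊕ π₂ ≡ just π →
       (((at α A) ^ π) ⊨ₑ (((at α A) ^ π₁) ⊛ ((at α A) ^ π₂)))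
       × ((((at α A) ^ π₁) ⊛ ((at α A) ^ π₂)) ⊨ₑ ((at α A) ^ π))
lemma2 Val Loc Var Label PA A α π₁ π₂ π π₁⊕π₂≡π = split , join
  where
  open Semantics Val Loc Var Label PA
  open LabelledPermissions Val Loc Var Label PA

  split : (at α A ^ π) ⊨ₑ ((at α A ^ π₁) ⊛ (at α A ^ π₂))
  split s h ρ sat with at^-elim A α π s h ρ sat
  ... | h≈π·ρα , A-holds =
    scale π₁ (ρ α) , scale π₂ (ρ α) ,
    (λ ℓ → subst (CompAt _ _) (sym (h≈π·ρα ℓ)) (IsWComp-scale π₁⊕π₂≡π (ρ α) ℓ)) ,
    at^-intro A α π₁ s (scale π₁ (ρ α)) ρ (λ _ → refl) A-holds ,
    at^-intro A α π₂ s (scale π₂ (ρ α)) ρ (λ _ → refl) A-holds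

  join : ((at α A ^ π₁) ⊛ (at α A ^ π₂)) ⊨ₑ (at α A ^ π)
  join s h ρ (h₁ , h₂ , h≡h₁∘h₂ , sat₁ , sat₂)
    with at^-elim A α π₁ s h₁ ρ sat₁ | at^-elim A α π₂ s h₂ ρ sat₂
  ... | h₁≈π₁·ρα , A-holds | h₂≈π₂·ρα , _ =
    at^-intro A α π s h ρ
      (IsWComp-scale⁻¹ π₁⊕π₂≡π h h₁ h₂ (ρ α) h₁≈π₁·ρα h₂≈π₂·ρα h≡h₁∘h₂)
      A-holds
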